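{- Let $w\in S_\infty$, let $i\geq 1$ and $l\geq 1$. The set $A_{l,i}(w)$ is non-empty if and only if $\ell(s_iw)>\ell(w)$ and $w^{ -1}(i)\leq l<w^{ -1}(i+1)$. Moreover, for such a value of $l$ there exists an index $1\leq j\leq l$ with $w^l_j=i$, and then $A_{l,i}(w)$ is the set of those $\alpha\in A_l(w)$ with $\alpha_j=i$ and such that $i+1$ does not occur in $\alpha$.
   Context: $S_n$ is the symmetric group on $\{1,\dots,n\}$, viewed inside $S_{n+1}$ as the stabilizer of $n+1$, and $S_\infty=\bigcup_n S_n$. Permutations compose as functions, $(uv)(x)=u(v(x))$. $s_i$ denotes the simple transposition interchanging $i$ and $i+1$, and $\ell(w)$ is the length of $w$ (the minimal number of simple transpositions whose product is $w$, equivalently the number of inversions of $w$). For $l\geq1$, $w^l=(w^l_1<\dots<w^l_l)$ is the increasing ordering of $w(1),\dots,w(l)$. For strictly increasing sequences $\alpha,\gamma$ of the same length $l$ write $\alpha\leq\gamma$ if $\alpha_j\leq\gamma_j$ for all $j$. $A_l(w)$ is the set of strictly increasing sequences $\alpha=(\alpha_1<\dots<\alpha_l)$ of positive integers with $\alpha\leq w^l$. Increasing sequences are identified with finite sets. For such $\alpha$, $s_i\alpha$ is the increasing sequence whose set of entries is $\{s_i(\alpha_1),\dots,s_i(\alpha_l)\}$. Finally $A_{l,i}(w):=\{\alpha\in A_l(w): s_i\alpha\notin A_l(w)\}$. -}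

module Defs where

open import Data.Nat using (ℕ; zero; suc; _+_; _∸_; _≤_; _<_; _⊔_; _≟_; _<?_; s≤s; z≤n)
open import Data.Nat.Properties using (≤-decTotalOrder; <-irrefl; ≤-<-trans; m≤m⊔n; m≤n⊔m; <-trans; n<1+n; ≤-refl; m≤n⇒m<n∨m≡n)
open import Data.List using (List; []; _∷_; map; filter; length; concatMap; upTo)
open import Data.List.Relation.Unary.All using (All)
open import Data.List.Relation.Unary.Linked using (Linked)
open import Data.List.Relation.Binary.Pointwise using (Pointwise)
open import Data.List.Membership.Propositional using (_∈_)
open import Data.Product using (Σ; _×_; _,_; proj₁; proj₂)
open import Data.Maybe using (Maybe; just; nothing)
open import Relation.Nullary using (¬_; yes; no)
open import Relation.Binary.PropositionalEquality using (_≡_; refl; sym; trans; cong)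
open import Data.Empty using (⊥-elim)
open import Data.List.Sort.InsertionSort ≤-decTotalOrder using (sort)

-- We work with functions ℕ → ℕ; the paper's domain is
-- the positive integers, so we additionally require w(0) = 0.  A
-- permutation is a bijection (explicit two-sided inverse) fixing every
-- x > bound (finite support).

record Perm : Set where
  field
    fun     : ℕ → ℕ
    inv     : ℕ → ℕ
    inv-fun : ∀ x → inv (fun x) ≡ x
    fun-inv : ∀ x → fun (inv x) ≡ x
    fix0    : fun 0 ≡ 0
    bound   : ℕ
    fixBig  : ∀ x → bound < x → fun x ≡ x

open Perm public

-- the list [a, a+1, ..., b]  (empty if b < a)
range : ℕ → ℕ → List ℕ
range a b = map (a +_) (upTo (suc b ∸ a))

pairsUpTo : ℕ → List (ℕ × ℕ)
pairsUpTo N = concatMap (λ b → map (λ a → (a , b)) (range 1 (b ∸ 1))) (range 1 N)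

-- length ℓ(w) = number of inversions: pairs a < b with w(a) > w(b).
-- All inversions lie in {1..bound w} since w fixes everything larger.
len : Perm → ℕ
len w = length (filter (λ p → fun w (proj₂ p) <? fun w (proj₁ p)) (pairsUpTo (bound w)))

swap : ℕ → ℕ → ℕ
swap i x with x ≟ i
... | yes _ = suc i
... | no _ with x ≟ suc i
...   | yes _ = i
...   | no _ = x

swap-invol : ∀ i x → swap i (swap i x) ≡ x
swap-invol i x with x ≟ i
swap-invol i x | yes x≡i with suc i ≟ i
... | yes e = ⊥-elim (<-irrefl (sym e) (n<1+n i))
... | no _ with suc i ≟ suc i
...   | yes _ = sym x≡i
...   | no ne = ⊥-elim (ne refl)
swap-invol i x | no x≢i with x ≟ suc i
swap-invol i x | no x≢i | yes x≡si with i ≟ i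
... | yes _ = sym x≡si
... | no ne = ⊥-elim (ne refl)
swap-invol i x | no x≢i | no x≢si with x ≟ i
... | yes e = ⊥-elim (x≢i e)
... | no _ with x ≟ suc i
...   | yes e = ⊥-elim (x≢si e)
...   | no _ = refl

swap-fix : ∀ i x → ¬ x ≡ i → ¬ x ≡ suc i → swap i x ≡ x
swap-fix i x p q with x ≟ i
... | yes e = ⊥-elim (p e)
... | no _ with x ≟ suc i
...   | yes e = ⊥-elim (q e)
...   | no _ = refl

private
  big-ne : ∀ {m x} → m < x → ¬ x ≡ m
  big-ne m<x refl = <-irrefl refl m<x

sMul : (i : ℕ) → 1 ≤ i → Perm → Perm
sMul i 1≤i w = record
  { fun     = λ x → swap i (fun w x)
  ; inv     = λ x → inv w (swap i x)
  ; inv-fun = λ x → trans (cong (inv w) (swap-invol i (fun w x))) (inv-fun w x)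
  ; fun-inv = λ x → trans (cong (swap i) (fun-inv w (swap i x))) (swap-invol i x)
  ; fix0    = trans (cong (swap i) (fix0 w))
                    (swap-fix i 0 (λ e → big-ne 1≤i (sym e)) (λ ()))
  ; bound   = bound w ⊔ suc i
  ; fixBig  = λ x b<x →
      let x>N  = ≤-<-trans (m≤m⊔n (bound w) (suc i)) b<x
          x>si = ≤-<-trans (m≤n⊔m (bound w) (suc i)) b<x
      in trans (cong (swap i) (fixBig w x x>N))
               (swap-fix i x (big-ne (<-trans (n<1+n i) x>si)) (big-ne x>si))
  }

wSeq : Perm → ℕ → List ℕ
wSeq w l = sort (map (fun w) (range 1 l))

InA : Perm → ℕ → List ℕ → Set
InA w l α = Linked _<_ α × All (λ x → 1 ≤ x) α × length α ≡ l × Pointwise _≤_ α (wSeq w l)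

sSeq : ℕ → List ℕ → List ℕ
sSeq i α = sort (map (swap i) α)

InAli : Perm → ℕ → ℕ → List ℕ → Set
InAli w l i α = InA w l α × ¬ InA w l (sSeq i α)

-- 1-indexed lookup: at j xs = just (xs_j), or nothing if out of range
at : ℕ → List ℕ → Maybe ℕ
at zero _ = nothing
at (suc j) [] = nothing
at (suc zero) (x ∷ xs) = just x
at (suc (suc j)) (x ∷ xs) = at (suc j) xs

{-# OPTIONS --safe #-}
module Submission where

-- Write s = w^l, a strictly increasing sequence.  For increasing α, s_iα is α itself unless
-- exactly one of i, i+1 occurs in α, and then it is α with that entry replaced by the other.
-- Replacing i+1 by i keeps α ≤ s, while replacing i by i+1 breaks α ≤ s exactly when i sits at
-- the same position j in α and in s.  Hence α ∈ A_{l,i}(w) iff i+1 ∉ α and α_j = s_j = i.  Such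
-- an α forces i ∈ s and i+1 ∉ s (s_k = i+1 would give i = α_j < α_k ≤ s_k, so α_k = i+1), that is
-- w⁻¹(i) ≤ l < w⁻¹(i+1); conversely α = s then works.  Finally w⁻¹(i) < w⁻¹(i+1) means that s_iw
-- keeps every inversion of w and gains the inversion (w⁻¹(i), w⁻¹(i+1)).

open import Defs
open import Data.Empty using (⊥-elim)
open import Data.Maybe using (just)
open import Data.Nat using (ℕ; zero; suc; _+_; _∸_; _⊔_; _≤_; _<_; _≤′_; ≤′-refl; ≤′-step; _≟_; _≤?_; _<?_; s≤s; z≤n)
open import Data.Nat.Properties
open import Data.Product using (Σ; _×_; _,_; proj₁; proj₂; uncurry)
open import Function using (_∘_; id)
open import Function.Bundles using (_⇔_; mk⇔; Equivalence)
open import Relation.Nullary using (¬_; yes; no)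
open import Relation.Unary using (Decidable)
open import Relation.Binary.PropositionalEquality using (_≡_; _≢_; refl; sym; trans; cong; subst; subst₂; setoid; module ≡-Reasoning)
open import Data.List using (List; []; _∷_; _++_; [_]; map; concatMap; filter; length; upTo)
open import Data.List.Properties using (map-id-local; map-++; concatMap-++; length-map; length-upTo; upTo-∷ʳ)
open import Data.List.Membership.Propositional using (_∈_; _∉_; find; lose)
open import Data.List.Membership.Propositional.Properties using (∈-map⁺; ∈-map⁻; ∈-upTo⁺; ∈-upTo⁻; ∈-concatMap⁺; ∈-concatMap⁻; ∈-filter⁺; ∈-filter⁻)
open import Data.List.Membership.DecPropositional _≟_ using (_∈?_)
open import Data.List.Relation.Unary.All as All using (All; []; _∷_)
import Data.List.Relation.Unary.All.Properties as AllP
open import Data.List.Relation.Unary.Any using (here; there)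
open import Data.List.Relation.Unary.AllPairs as AllPairs using (AllPairs)
open import Data.List.Relation.Unary.Linked as Linked using (Linked; []; [-]; _∷_)
open import Data.List.Relation.Unary.Linked.Properties using (Linked⇒All; AllPairs⇒Linked)
open import Data.List.Relation.Unary.Unique.Propositional using (Unique)
import Data.List.Relation.Unary.Unique.Propositional.Properties as Unique
open import Data.List.Relation.Unary.Sorted.TotalOrder.Properties using (↗↭↗⇒≋; Sorted⇒AllPairs)
open import Data.List.Relation.Binary.Pointwise as Pointwise using (Pointwise; []; _∷_; Pointwise-≡⇒≡)
open import Data.List.Relation.Binary.Permutation.Propositional using (_↭_; ↭-refl; ↭-sym; ↭-trans; prep; ↭⇒↭ₛ)
import Data.List.Relation.Binary.Permutation.Propositional as ↭
open import Data.List.Relation.Binary.Permutation.Propositional.Properties using (∈-resp-↭; ↭-length)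
open import Data.List.Relation.Binary.Permutation.Setoid.Properties using (Unique-resp-↭)
open import Data.List.Relation.Binary.Sublist.Propositional using (_⊆_; []; _∷_; _∷ʳ_; ⊆-refl; ⊆-trans)
open import Data.List.Relation.Binary.Sublist.Propositional.Properties using (++⁺ʳ; filter⁺; length-mono-≤; to-≋)
open import Data.List.Sort.InsertionSort ≤-decTotalOrder using (sort)
open import Data.List.Sort.InsertionSort.Properties ≤-decTotalOrder using (sort-↭; sort-↗)

data SwapView (i : ℕ) : ℕ → ℕ → Set where
  left  : SwapView i i (suc i)
  right : SwapView i (suc i) i
  other : ∀ {x} → x ≢ i → x ≢ suc i → SwapView i x x

swapView : ∀ i x → SwapView i x (swap i x)
swapView i x with x ≟ i
... | yes refl = left
... | no x≢i with x ≟ suc i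
...   | yes refl = right
...   | no x≢si = other x≢i x≢si

swap-i≡1+i : ∀ i → swap i i ≡ suc i
swap-i≡1+i i with swap i i | swapView i i
... | _ | left = refl
... | _ | other i≢i _ = ⊥-elim (i≢i refl)

swap-1+i≡i : ∀ i → swap i (suc i) ≡ i
swap-1+i≡i i with swap i (suc i) | swapView i (suc i)
... | _ | right = refl
... | _ | other _ si≢si = ⊥-elim (si≢si refl)

swap-<-mono : ∀ i {x y} → x < y → ¬ (x ≡ i × y ≡ suc i) → swap i x < swap i y
swap-<-mono i {x} {y} x<y ¬adj with swap i x | swapView i x | swap i y | swapView i y
... | _ | left      | _ | left      = ⊥-elim (<-irrefl refl x<y)
... | _ | left      | _ | right     = ⊥-elim (¬adj (refl , refl))
... | _ | left      | _ | other _ b = ≤∧≢⇒< x<y (b ∘ sym)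
... | _ | right     | _ | left      = ⊥-elim (<-asym x<y (n<1+n i))
... | _ | right     | _ | right     = ⊥-elim (<-irrefl refl x<y)
... | _ | right     | _ | other _ _ = <-trans (n<1+n i) x<y
... | _ | other _ _ | _ | left      = <-trans x<y (n<1+n i)
... | _ | other a _ | _ | right     = ≤∧≢⇒< (≤-pred x<y) a
... | _ | other _ _ | _ | other _ _ = x<y

swap-positive : ∀ i {x} → 1 ≤ i → 1 ≤ x → 1 ≤ swap i x
swap-positive i {x} 1≤i 1≤x with swap i x | swapView i x
... | _ | left      = s≤s z≤n
... | _ | right     = 1≤i
... | _ | other _ _ = 1≤x

swap-≤ : ∀ i {x} → x ≢ i → swap i x ≤ x
swap-≤ i {x} x≢i with swap i x | swapView i x
... | _ | left      = ⊥-elim (x≢i refl)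
... | _ | right     = n≤1+n i
... | _ | other _ _ = ≤-refl

swap-≰⇒≡ : ∀ i {x y} → x ≤ y → x ≢ suc i → ¬ swap i x ≤ y → x ≡ i × y ≡ i
swap-≰⇒≡ i {x} {y} x≤y x≢si sx≰y with swap i x | swapView i x
... | _ | left      = refl , ≤-antisym (≤-pred (≰⇒> sx≰y)) x≤y
... | _ | right     = ⊥-elim (x≢si refl)
... | _ | other _ _ = ⊥-elim (sx≰y x≤y)

Increasing : List ℕ → Set
Increasing = Linked _<_

Increasing⇒head< : ∀ {x xs} → Increasing (x ∷ xs) → All (x <_) xs
Increasing⇒head< [-]          = []
Increasing⇒head< (x<y ∷ incr) = Linked⇒All <-trans x<y incr

Increasing-tail : ∀ {x xs} → Increasing (x ∷ xs) → Increasing xs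
Increasing-tail [-]        = []
Increasing-tail (_ ∷ incr) = incr

sort-Increasing : ∀ {xs ys} → Increasing ys → ys ↭ xs → sort xs ≡ ys
sort-Increasing {xs} {ys} incr ys↭xs = Pointwise-≡⇒≡
  (↗↭↗⇒≋ ≤-totalOrder (sort-↗ xs) (Linked.map <⇒≤ incr)
          (↭⇒↭ₛ (↭-trans (sort-↭ xs) (↭-sym ys↭xs))))

map-swap-above : ∀ i {xs} → All (suc i <_) xs → map (swap i) xs ≡ xs
map-swap-above i = map-id-local ∘ All.map λ {x} si<x →
  swap-fix i x (λ { refl → <-asym si<x (n<1+n i) }) (λ { refl → <-irrefl refl si<x })

map-swap-Increasing : ∀ i {xs} → Increasing xs → ¬ (i ∈ xs × suc i ∈ xs) →
  Increasing (map (swap i) xs)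
map-swap-Increasing i []                 _    = []
map-swap-Increasing i [-]                _    = [-]
map-swap-Increasing i (x<y ∷ incr) ¬both =
  swap-<-mono i x<y (λ { (refl , refl) → ¬both (here refl , there (here refl)) })
  ∷ map-swap-Increasing i incr (λ { (i∈ , si∈) → ¬both (there i∈ , there si∈) })

map-swap-↭ : ∀ i {xs} → Increasing xs → i ∈ xs → suc i ∈ xs → map (swap i) xs ↭ xs
map-swap-↭ i {x ∷ xs} incr i∈ si∈ with swap i x | swapView i x
map-swap-↭ i {_ ∷ _ ∷ xs} (_ ∷ incr) _ (there (here refl)) | _ | left
  rewrite swap-1+i≡i i | map-swap-above i (Increasing⇒head< incr) = ↭.swap (suc i) i ↭-refl
map-swap-↭ i {_ ∷ _ ∷ _} (i<y ∷ incr) _ (there (there si∈)) | _ | left =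
  ⊥-elim (<⇒≱ i<y (≤-pred (All.lookup (Increasing⇒head< incr) si∈)))
map-swap-↭ i _ _ (here si≡i) | _ | left = ⊥-elim (<-irrefl (sym si≡i) (n<1+n i))
map-swap-↭ i _ (here i≡si) _ | _ | right = ⊥-elim (<-irrefl i≡si (n<1+n i))
map-swap-↭ i incr (there i∈) _ | _ | right =
  ⊥-elim (<-asym (n<1+n i) (All.lookup (Increasing⇒head< incr) i∈))
map-swap-↭ i _ (here refl) _ | _ | other x≢i _ = ⊥-elim (x≢i refl)
map-swap-↭ i _ (there _) (here refl) | _ | other _ x≢si = ⊥-elim (x≢si refl)
map-swap-↭ i incr (there i∈) (there si∈) | x | other _ _ =
  prep x (map-swap-↭ i (Increasing-tail incr) i∈ si∈)

sSeq-both : ∀ i {α} → Increasing α → i ∈ α → suc i ∈ α → sSeq i α ≡ α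
sSeq-both i incr i∈ si∈ = sort-Increasing incr (↭-sym (map-swap-↭ i incr i∈ si∈))

sSeq-not-both : ∀ i {α} → Increasing α → ¬ (i ∈ α × suc i ∈ α) → sSeq i α ≡ map (swap i) α
sSeq-not-both i incr ¬both = sort-Increasing (map-swap-Increasing i incr ¬both) ↭-refl

-- A_l(w) with w^l replaced by an arbitrary bound s.
Below : ℕ → List ℕ → List ℕ → Set
Below l s α = Increasing α × All (1 ≤_) α × length α ≡ l × Pointwise _≤_ α s

map-swap-≤ : ∀ i {α s} → i ∉ α → Pointwise _≤_ α s → Pointwise _≤_ (map (swap i) α) s
map-swap-≤ i i∉ []         = []
map-swap-≤ i i∉ (x≤y ∷ pw) =
  ≤-trans (swap-≤ i (i∉ ∘ here ∘ sym)) x≤y ∷ map-swap-≤ i (i∉ ∘ there) pw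

Below-sSeq⇔ : ∀ {i l s α} → 1 ≤ i → Below l s α → ¬ (i ∈ α × suc i ∈ α) →
  Below l s (sSeq i α) ⇔ Pointwise _≤_ (map (swap i) α) s
Below-sSeq⇔ {i} {α = α} 1≤i (incr , pos , len-α , _) ¬both rewrite sSeq-not-both i incr ¬both =
  mk⇔ (λ (_ , _ , _ , pw) → pw)
      (λ pw → map-swap-Increasing i incr ¬both , AllP.map⁺ (All.map (swap-positive i 1≤i) pos)
            , trans (length-map (swap i) α) len-α , pw)

sSeq-escape : ∀ {i l s α} → 1 ≤ i → Below l s α → ¬ Below l s (sSeq i α) →
  suc i ∉ α × ¬ Pointwise _≤_ (map (swap i) α) s
sSeq-escape {i} {α = α} 1≤i b@(incr , _ , _ , pw) ¬b with i ∈? α | suc i ∈? α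
... | yes i∈ | yes si∈ = ⊥-elim (¬b (subst (Below _ _) (sym (sSeq-both i incr i∈ si∈)) b))
... | yes _  | no si∉  = si∉ , ¬b ∘ Equivalence.from (Below-sSeq⇔ 1≤i b (si∉ ∘ proj₂))
... | no i∉  | _       =
  ⊥-elim (¬b (Equivalence.from (Below-sSeq⇔ 1≤i b (i∉ ∘ proj₁)) (map-swap-≤ i i∉ pw)))

at-∈ : ∀ j {xs} {x : ℕ} → at j xs ≡ just x → x ∈ xs
at-∈ (suc zero)    {_ ∷ _} refl = here refl
at-∈ (suc (suc j)) {_ ∷ _} xj   = there (at-∈ (suc j) xj)

∈⇒at : ∀ {xs} {x : ℕ} → x ∈ xs → Σ ℕ λ j → 1 ≤ j × j ≤ length xs × at j xs ≡ just x
∈⇒at (here refl) = 1 , s≤s z≤n , s≤s z≤n , refl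
∈⇒at (there x∈) with ∈⇒at x∈
... | suc j , _ , j≤ , xj = suc (suc j) , s≤s z≤n , s≤s j≤ , xj

at-injective : ∀ j k {s} {x : ℕ} → Increasing s → at j s ≡ just x → at k s ≡ just x → j ≡ k
at-injective (suc zero)    (suc zero)    {_ ∷ _} _    _  _  = refl
at-injective (suc zero)    (suc (suc k)) {_ ∷ _} incr refl xk =
  ⊥-elim (<-irrefl refl (All.lookup (Increasing⇒head< incr) (at-∈ (suc k) xk)))
at-injective (suc (suc j)) (suc zero)    {_ ∷ _} incr xj refl =
  ⊥-elim (<-irrefl refl (All.lookup (Increasing⇒head< incr) (at-∈ (suc j) xj)))
at-injective (suc (suc j)) (suc (suc k)) {_ ∷ _} incr xj xk =
  cong suc (at-injective (suc j) (suc k) (Increasing-tail incr) xj xk)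

swap-not-≤⇒aligned : ∀ i {α s} → Pointwise _≤_ α s → suc i ∉ α →
  ¬ Pointwise _≤_ (map (swap i) α) s → Σ ℕ λ j → at j α ≡ just i × at j s ≡ just i
swap-not-≤⇒aligned i [] _ ¬pw = ⊥-elim (¬pw [])
swap-not-≤⇒aligned i {x ∷ _} {y ∷ _} (x≤y ∷ pw) si∉ ¬pw with swap i x ≤? y
... | no sx≰y with refl , refl ← swap-≰⇒≡ i x≤y (si∉ ∘ here ∘ sym) sx≰y = 1 , refl , refl
... | yes sx≤y with swap-not-≤⇒aligned i pw (si∉ ∘ there) (¬pw ∘ (sx≤y ∷_))
...   | suc j , αj , sj = suc (suc j) , αj , sj

aligned⇒swap-not-≤ : ∀ i j {α s} → at j α ≡ just i → at j s ≡ just i →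
  ¬ Pointwise _≤_ (map (swap i) α) s
aligned⇒swap-not-≤ i (suc zero)    {_ ∷ _} {_ ∷ _} refl refl (si≤i ∷ _) =
  1+n≰n (subst (_≤ i) (swap-i≡1+i i) si≤i)
aligned⇒swap-not-≤ i (suc (suc j)) {_ ∷ _} {_ ∷ _} αj sj (_ ∷ pw) =
  aligned⇒swap-not-≤ i (suc j) αj sj pw

suc-∈-squeeze : ∀ i {xs ys} → All (i <_) xs → Pointwise _≤_ xs ys → suc i ∈ ys → suc i ∈ xs
suc-∈-squeeze i (i<x ∷ _)   (x≤y ∷ _)  (here refl)  = here (≤-antisym i<x x≤y)
suc-∈-squeeze i (_ ∷ i<xs) (_ ∷ pw) (there si∈) = there (suc-∈-squeeze i i<xs pw si∈)

aligned⇒suc∉ : ∀ i j {α s} → Increasing α → Increasing s → Pointwise _≤_ α s →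
  at j α ≡ just i → at j s ≡ just i → suc i ∉ α → suc i ∉ s
aligned⇒suc∉ i (suc zero) {_ ∷ _} {_ ∷ _} _ _ _ refl refl _ (here si≡i) =
  <-irrefl (sym si≡i) (n<1+n i)
aligned⇒suc∉ i (suc zero) {_ ∷ _} {_ ∷ _} incrα _ (_ ∷ pw) refl refl si∉ (there si∈) =
  si∉ (there (suc-∈-squeeze i (Increasing⇒head< incrα) pw si∈))
aligned⇒suc∉ i (suc (suc j)) {_ ∷ _} {_ ∷ _} _ incrs _ _ sj _ (here refl) =
  <-asym (n<1+n i) (All.lookup (Increasing⇒head< incrs) (at-∈ (suc j) sj))
aligned⇒suc∉ i (suc (suc j)) {_ ∷ _} {_ ∷ _} incrα incrs (_ ∷ pw) αj sj si∉ (there si∈) =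
  aligned⇒suc∉ i (suc j) (Increasing-tail incrα) (Increasing-tail incrs) pw αj sj (si∉ ∘ there) si∈

escape⇒window : ∀ {i l s α} → 1 ≤ i → Increasing s → Below l s α → ¬ Below l s (sSeq i α) →
  i ∈ s × suc i ∉ s
escape⇒window {i} 1≤i incrs b@(incrα , _ , _ , pw) ¬b with sSeq-escape 1≤i b ¬b
... | si∉ , ¬pw with j , αj , sj ← swap-not-≤⇒aligned i pw si∉ ¬pw =
  at-∈ j sj , aligned⇒suc∉ i j incrα incrs pw αj sj si∉

escape⇔aligned : ∀ {i l s j} → 1 ≤ i → Increasing s → at j s ≡ just i → (α : List ℕ) →
  (Below l s α × ¬ Below l s (sSeq i α)) ⇔ (Below l s α × at j α ≡ just i × suc i ∉ α)
escape⇔aligned {i} {l} {s} {j} 1≤i incrs sj α = mk⇔ escape⇒aligned aligned⇒escape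
  where
  escape⇒aligned : Below l s α × ¬ Below l s (sSeq i α) →
    Below l s α × at j α ≡ just i × suc i ∉ α
  escape⇒aligned (b@(_ , _ , _ , pw) , ¬b) with si∉ , ¬pw ← sSeq-escape 1≤i b ¬b
                                           with k , αk , sk ← swap-not-≤⇒aligned i pw si∉ ¬pw =
    b , subst (λ k → at k α ≡ just i) (at-injective k j incrs sk sj) αk , si∉
  aligned⇒escape : Below l s α × at j α ≡ just i × suc i ∉ α →
    Below l s α × ¬ Below l s (sSeq i α)
  aligned⇒escape (b , αj , si∉) =
    b , aligned⇒swap-not-≤ i j αj sj ∘ Equivalence.to (Below-sSeq⇔ 1≤i b (si∉ ∘ proj₂))

range-∈⁺ : ∀ {k l} → 1 ≤ k → k ≤ l → k ∈ range 1 l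
range-∈⁺ {suc k} _ k≤l = ∈-map⁺ (1 +_) (∈-upTo⁺ k≤l)

range-∈⁻ : ∀ {k l} → k ∈ range 1 l → 1 ≤ k × k ≤ l
range-∈⁻ k∈ with _ , k∈′ , refl ← ∈-map⁻ (1 +_) k∈ = s≤s z≤n , ∈-upTo⁻ k∈′

fun-injective : ∀ w {a b} → fun w a ≡ fun w b → a ≡ b
fun-injective w {a} {b} eq = trans (sym (inv-fun w a)) (trans (cong (inv w) eq) (inv-fun w b))

fun-positive : ∀ w {k} → 1 ≤ k → 1 ≤ fun w k
fun-positive w {suc k} _ = n≢0⇒n>0 (λ eq → 1+n≢0 (fun-injective w (trans eq (sym (fix0 w)))))

inv-positive : ∀ w {x} → 1 ≤ x → 1 ≤ inv w x
inv-positive w {suc x} _ =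
  n≢0⇒n>0 (λ eq → 1+n≢0 (trans (sym (fun-inv w (suc x))) (trans (cong (fun w) eq) (fix0 w))))

inv-≤-bound⊔ : ∀ w x → inv w x ≤ bound w ⊔ x
inv-≤-bound⊔ w x with inv w x ≤? bound w
... | yes ≤bound = ≤-trans ≤bound (m≤m⊔n (bound w) x)
... | no  ≰bound = subst (_≤ bound w ⊔ x) (sym inv≡x) (m≤n⊔m (bound w) x)
  where
  inv≡x : inv w x ≡ x
  inv≡x = trans (sym (fixBig w _ (≰⇒> ≰bound))) (fun-inv w x)

wSeq-↭ : ∀ w l → wSeq w l ↭ map (fun w) (range 1 l)
wSeq-↭ w l = sort-↭ (map (fun w) (range 1 l))

∈-wSeq⁺ : ∀ w l {x} → 1 ≤ x → inv w x ≤ l → x ∈ wSeq w l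
∈-wSeq⁺ w l {x} 1≤x x≤l = ∈-resp-↭ (↭-sym (wSeq-↭ w l))
  (subst (_∈ _) (fun-inv w x) (∈-map⁺ (fun w) (range-∈⁺ (inv-positive w 1≤x) x≤l)))

∈-wSeq⁻ : ∀ w l {x} → x ∈ wSeq w l → 1 ≤ x × inv w x ≤ l
∈-wSeq⁻ w l x∈ with k , k∈ , refl ← ∈-map⁻ (fun w) (∈-resp-↭ (wSeq-↭ w l) x∈)
               with 1≤k , k≤l ← range-∈⁻ k∈ =
  fun-positive w 1≤k , subst (_≤ l) (sym (inv-fun w k)) k≤l

wSeq-Increasing : ∀ w l → Increasing (wSeq w l)
wSeq-Increasing w l = AllPairs⇒Linked (AllPairs.zipWith (uncurry ≤∧≢⇒<) (sorted , unique))
  where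
  sorted : AllPairs _≤_ (wSeq w l)
  sorted = Sorted⇒AllPairs ≤-totalOrder (sort-↗ (map (fun w) (range 1 l)))
  unique : Unique (wSeq w l)
  unique = Unique-resp-↭ (setoid ℕ) (↭⇒↭ₛ (↭-sym (wSeq-↭ w l)))
             (Unique.map⁺ (fun-injective w) (Unique.map⁺ suc-injective (Unique.upTo⁺ l)))

length-wSeq : ∀ w l → length (wSeq w l) ≡ l
length-wSeq w l = begin
  length (wSeq w l)                          ≡⟨ ↭-length (wSeq-↭ w l) ⟩
  length (map (fun w) (range 1 l))           ≡⟨ length-map (fun w) (range 1 l) ⟩
  length (map (1 +_) (upTo l))               ≡⟨ length-map (1 +_) (upTo l) ⟩
  length (upTo l)                            ≡⟨ length-upTo l ⟩
  l                                          ∎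
  where open ≡-Reasoning

wSeq-Below : ∀ w l → Below l (wSeq w l) (wSeq w l)
wSeq-Below w l =
  wSeq-Increasing w l , All.tabulate (proj₁ ∘ ∈-wSeq⁻ w l) , length-wSeq w l , Pointwise.refl ≤-refl

∈-wSeq-window : ∀ w l {i} → 1 ≤ i →
  (i ∈ wSeq w l × suc i ∉ wSeq w l) ⇔ (inv w i ≤ l × l < inv w (suc i))
∈-wSeq-window w l 1≤i = mk⇔
  (λ (i∈ , si∉) → proj₂ (∈-wSeq⁻ w l i∈) , ≰⇒> (si∉ ∘ ∈-wSeq⁺ w l (s≤s z≤n)))
  (λ (i≤l , l<si) → ∈-wSeq⁺ w l 1≤i i≤l , <⇒≱ l<si ∘ proj₂ ∘ ∈-wSeq⁻ w l)

pairsUpTo-∈⁺ : ∀ {a b N} → 1 ≤ a → a < b → b ≤ N → (a , b) ∈ pairsUpTo N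
pairsUpTo-∈⁺ {b = suc b} 1≤a a<b b≤N =
  ∈-concatMap⁺ _ (lose (range-∈⁺ (s≤s z≤n) b≤N)
                       (∈-map⁺ (_, suc b) (range-∈⁺ 1≤a (≤-pred a<b))))

pairsUpTo-∈⁻ : ∀ {a b N} → (a , b) ∈ pairsUpTo N → a < b
pairsUpTo-∈⁻ {N = N} ab∈ with suc b , _ , ab∈′ ← find (∈-concatMap⁻ _ {xs = range 1 N} ab∈)
                         with _ , a∈ , refl ← ∈-map⁻ (_, suc b) ab∈′ =
  s≤s (proj₂ (range-∈⁻ a∈))

pairsUpTo-⊆-suc : ∀ N → pairsUpTo N ⊆ pairsUpTo (suc N)
pairsUpTo-⊆-suc N = subst (pairsUpTo N ⊆_) (sym split) (++⁺ʳ _ ⊆-refl)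
  where
  pairsEndingAt : ℕ → List (ℕ × ℕ)
  pairsEndingAt b = map (_, b) (range 1 (b ∸ 1))
  split : pairsUpTo (suc N) ≡ pairsUpTo N ++ concatMap pairsEndingAt [ suc N ]
  split = begin
    concatMap pairsEndingAt (map (1 +_) (upTo (suc N)))
      ≡⟨ cong (concatMap pairsEndingAt ∘ map (1 +_)) (upTo-∷ʳ N) ⟨
    concatMap pairsEndingAt (map (1 +_) (upTo N ++ [ N ]))
      ≡⟨ cong (concatMap pairsEndingAt) (map-++ (1 +_) (upTo N) [ N ]) ⟩
    concatMap pairsEndingAt (range 1 N ++ [ suc N ])
      ≡⟨ concatMap-++ pairsEndingAt (range 1 N) [ suc N ] ⟩
    pairsUpTo N ++ concatMap pairsEndingAt [ suc N ]
      ∎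
    where open ≡-Reasoning

pairsUpTo-mono : ∀ {N M} → N ≤′ M → pairsUpTo N ⊆ pairsUpTo M
pairsUpTo-mono ≤′-refl                    = ⊆-refl
pairsUpTo-mono {M = suc M} (≤′-step N≤′M) = ⊆-trans (pairsUpTo-mono N≤′M) (pairsUpTo-⊆-suc M)

module _ {A : Set} {P Q : A → Set} (P? : Decidable P) (Q? : Decidable Q) where

  filter-⊆ : ∀ {xs} → All (λ x → P x → Q x) xs → filter P? xs ⊆ filter Q? xs
  filter-⊆ []                  = []
  filter-⊆ {x ∷ _} (P⇒Q ∷ P⇒Qs) with P? x | Q? x
  ... | yes _  | yes _  = refl ∷ filter-⊆ P⇒Qs
  ... | yes px | no ¬qx = ⊥-elim (¬qx (P⇒Q px))
  ... | no _   | yes _  = _ ∷ʳ filter-⊆ P⇒Qs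
  ... | no _   | no _   = filter-⊆ P⇒Qs

  length-filter-< : ∀ {xs z} → All (λ x → P x → Q x) xs → z ∈ xs → Q z → ¬ P z →
    length (filter P? xs) < length (filter Q? xs)
  length-filter-< {xs} {z} P⇒Q z∈ qz ¬pz = ≤∧≢⇒< (length-mono-≤ sub) λ same-length →
    ¬pz (proj₂ (∈-filter⁻ P? {xs = xs} (subst (z ∈_) (sym (filters-equal same-length)) (∈-filter⁺ Q? z∈ qz))))
    where
    sub : filter P? xs ⊆ filter Q? xs
    sub = filter-⊆ P⇒Q
    filters-equal : length (filter P? xs) ≡ length (filter Q? xs) → filter P? xs ≡ filter Q? xs
    filters-equal same-length = Pointwise-≡⇒≡ (to-≋ same-length sub)

inversions : (ℕ → ℕ) → ℕ → ℕ
inversions f N = length (filter (λ p → f (proj₂ p) <? f (proj₁ p)) (pairsUpTo N))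

inversions-mono : ∀ f {N M} → N ≤ M → inversions f N ≤ inversions f M
inversions-mono f N≤M =
  length-mono-≤ (filter⁺ inverted? inverted? (λ { refl → id }) (pairsUpTo-mono (≤⇒≤′ N≤M)))
  where inverted? = λ (p : ℕ × ℕ) → f (proj₂ p) <? f (proj₁ p)

len-sMul : ∀ w i (1≤i : 1 ≤ i) → inv w i < inv w (suc i) → len w < len (sMul i 1≤i w)
len-sMul w i 1≤i p<q = begin-strict
  len w                           ≡⟨⟩
  inversions (fun w) (bound w)    ≤⟨ inversions-mono (fun w) (m≤m⊔n (bound w) (suc i)) ⟩
  inversions (fun w) M            <⟨ length-filter-< _ _ survives new-pair new-inverted old-not-inverted ⟩
  inversions (swap i ∘ fun w) M   ≡⟨⟩
  len (sMul i 1≤i w)              ∎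
  where
  open ≤-Reasoning
  M = bound w ⊔ suc i
  fun≡⇒≡inv : ∀ {a x} → fun w a ≡ x → a ≡ inv w x
  fun≡⇒≡inv {a} eq = trans (sym (inv-fun w a)) (cong (inv w) eq)
  survives : All (λ (p : ℕ × ℕ) → fun w (proj₂ p) < fun w (proj₁ p) →
                                  swap i (fun w (proj₂ p)) < swap i (fun w (proj₁ p)))
                 (pairsUpTo M)
  survives = All.tabulate λ ab∈ inverted → swap-<-mono i inverted λ (fb≡i , fa≡si) →
    <-asym p<q (subst₂ _<_ (fun≡⇒≡inv fa≡si) (fun≡⇒≡inv fb≡i) (pairsUpTo-∈⁻ {N = M} ab∈))
  new-pair : (inv w i , inv w (suc i)) ∈ pairsUpTo M
  new-pair = pairsUpTo-∈⁺ (inv-positive w 1≤i) p<q (inv-≤-bound⊔ w (suc i))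
  new-inverted : swap i (fun w (inv w (suc i))) < swap i (fun w (inv w i))
  new-inverted rewrite fun-inv w i | fun-inv w (suc i) | swap-i≡1+i i | swap-1+i≡i i = n<1+n i
  old-not-inverted : ¬ fun w (inv w (suc i)) < fun w (inv w i)
  old-not-inverted rewrite fun-inv w i | fun-inv w (suc i) = <-asym (n<1+n i)

lemma1p5 : (w : Perm) (i l : ℕ) (hi : 1 ≤ i) → 1 ≤ l →
    ((Σ (List ℕ) (λ α → InAli w l i α)) ⇔
       (len w < len (sMul i hi w) × inv w i ≤ l × l < inv w (suc i)))
    × ((len w < len (sMul i hi w) × inv w i ≤ l × l < inv w (suc i)) →
       Σ ℕ (λ j → (1 ≤ j × j ≤ l × at j (wSeq w l) ≡ just i)
         × ((α : List ℕ) → InAli w l i α ⇔ (InA w l α × at j α ≡ just i × ¬ (suc i ∈ α)))))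
lemma1p5 w i l 1≤i _ = mk⇔ nonempty⇒window window⇒nonempty , characterisation ∘ proj₂
  where
  s : List ℕ
  s = wSeq w l
  Window : Set
  Window = inv w i ≤ l × l < inv w (suc i)
  window⇔ : (i ∈ s × suc i ∉ s) ⇔ Window
  window⇔ = ∈-wSeq-window w l 1≤i
  nonempty⇒window : Σ (List ℕ) (InAli w l i) → len w < len (sMul i 1≤i w) × Window
  nonempty⇒window (_ , b , ¬b) =
    let window = Equivalence.to window⇔ (escape⇒window 1≤i (wSeq-Increasing w l) b ¬b)
    in len-sMul w i 1≤i (uncurry ≤-<-trans window) , window
  characterisation : Window → Σ ℕ λ j → (1 ≤ j × j ≤ l × at j s ≡ just i)
    × ((α : List ℕ) → InAli w l i α ⇔ (InA w l α × at j α ≡ just i × suc i ∉ α))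
  characterisation window with j , 1≤j , j≤ , sj ← ∈⇒at (proj₁ (Equivalence.from window⇔ window)) =
    j , (1≤j , subst (j ≤_) (length-wSeq w l) j≤ , sj)
      , escape⇔aligned {l = l} {j = j} 1≤i (wSeq-Increasing w l) sj
  window⇒nonempty : len w < len (sMul i 1≤i w) × Window → Σ (List ℕ) (InAli w l i)
  window⇒nonempty (_ , window) with _ , (_ , _ , sj) , escapes⇔aligned ← characterisation window =
    s , Equivalence.from (escapes⇔aligned s)
          (wSeq-Below w l , sj , proj₂ (Equivalence.from window⇔ window))
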